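{- Let $G$ be an undirected graph on $n$ vertices, let $b$ be a positive integer, let $\eta>0$, and let $G^b$ be the multigraph obtained from $G$ by replacing every edge by $b$ parallel copies. Let $\rho_b$ denote the maximum subgraph density of $G^b$. Let $\overrightarrow{G}^b$ be any orientation of $G^b$ such that, for some constant $c\ge 0$, every directed edge $\overrightarrow{uv}$ of $\overrightarrow{G}^b$ satisfies $d^+(u) \le (1+\eta b^{ -1})\, d^+(v) + c$. Then for any constant $\gamma>0$ there exists a value $k_{\max} \le \log_{1+\gamma} n$ such that \[ (1+\eta b^{ -1})^{ -k_{\max}}\,\Delta(\overrightarrow{G}^b) \le (1+\gamma)\rho_b + c(\eta^{ -1} b + 1). \]
   Context: For a (multi)graph $H=(V,E)$, the maximum subgraph density is $\max_{\emptyset\ne S\subseteq V} |E(S)|/|S|$, where $E(S)$ is the multiset of edges with both endpoints in $S$. An orientation assigns a direction to each edge (each parallel copy separately). $d^+(u)$ is the out-degree of $u$ (number of edge copies directed out of $u$, counted with multiplicity), and $\Delta(\overrightarrow{H}) = \max_{v} d^+(v)$ is the maximum out-degree of the orientation.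
   Formalization: The parameters η and γ and the constant c take rational values. -}

module Defs where

open import Data.Nat as ℕ using (ℕ; zero; suc)
open import Data.Nat.ListAction using (sum)
open import Data.Bool using (Bool; true; false; if_then_else_; _∧_)
open import Data.Fin using (Fin; toℕ)
open import Data.Fin.Subset using (Subset; inside; outside; ∣_∣)
open import Data.List using (List; []; _∷_; map; foldr; _++_; allFin)
open import Data.Vec using (Vec; []; _∷_; lookup)
open import Data.Integer using (+_)
open import Data.Rational using (ℚ; 0ℚ; 1ℚ; _/_; _*_; _⊔_)
open import Relation.Binary.PropositionalEquality using (_≡_)

record Graph (n : ℕ) : Set where
  field
    adj    : Fin n → Fin n → Bool
    sym    : ∀ u v → adj u v ≡ adj v u
    irrefl : ∀ u → adj u u ≡ false
open Graph public

-- Since parallel copies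
-- are interchangeable, an orientation is recorded by  out u v  = the number
-- of copies of the edge {u,v} directed from u to v.
record Orientation {n : ℕ} (G : Graph n) (b : ℕ) : Set where
  field
    out        : Fin n → Fin n → ℕ
    out-nonadj : ∀ u v → adj G u v ≡ false → out u v ≡ 0
    out-split  : ∀ u v → adj G u v ≡ true → out u v ℕ.+ out v u ≡ b
open Orientation public

outdeg : ∀ {n} {G : Graph n} {b} → Orientation G b → Fin n → ℕ
outdeg {n} o u = sum (map (out o u) (allFin n))

maxOutdeg : ∀ {n} {G : Graph n} {b} → Orientation G b → ℕ
maxOutdeg {n} o = foldr ℕ._⊔_ 0 (map (outdeg o) (allFin n))

IsDirectedEdge : ∀ {n} {G : Graph n} {b} → Orientation G b → Fin n → Fin n → Set
IsDirectedEdge o u v = 0 ℕ.< out o u v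

allSubsets : (n : ℕ) → List (Subset n)
allSubsets zero    = [] ∷ []
allSubsets (suc n) = map (inside ∷_) (allSubsets n) ++ map (outside ∷_) (allSubsets n)

edgesIn : ∀ {n} → Graph n → Subset n → ℕ
edgesIn {n} G S =
  sum (map (λ u → sum (map (λ v →
        if (toℕ u ℕ.<ᵇ toℕ v) ∧ adj G u v ∧ lookup S u ∧ lookup S v then 1 else 0)
      (allFin n))) (allFin n))

-- m / k as a rational (only used with k ≥ 1)
ratio : ℕ → ℕ → ℚ
ratio m zero    = 0ℚ
ratio m (suc k) = (+ m) / suc k

-- density |E_{G^b}(S)| / |S| of S in the multigraph G^b  (|E_{G^b}(S)| = b · |E_G(S)|)
densityᵇ : ∀ {n} → Graph n → ℕ → Subset n → ℚ
densityᵇ G b S = ratio (b ℕ.* edgesIn G S) ∣ S ∣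

-- maximum subgraph density ρ_b of G^b.  (The empty set contributes 0, which
-- does not affect the maximum since all densities are ≥ 0 and n ≥ 1.)
maxDensityᵇ : ∀ {n} → Graph n → ℕ → ℚ
maxDensityᵇ {n} G b = foldr _⊔_ 0ℚ (map (densityᵇ G b) (allSubsets n))

_^ℚ_ : ℚ → ℕ → ℚ
q ^ℚ zero  = 1ℚ
q ^ℚ suc k = q * (q ^ℚ k)

-- Let v₀ attain the maximum out-degree Δ and let B_i be the set of vertices reachable from v₀
-- along at most i directed edges. With q = 1 + η/b and K = b/η + 1 we have c + cK ≤ q·cK, so the
-- edge condition d⁺(u) ≤ q·d⁺(v) + c propagates along paths to Δ ≤ q^i (d⁺(v) + cK) on B_i.
-- Since |B_i| ≤ n, the balls cannot keep growing by a factor 1 + γ: some k has (1+γ)^k ≤ |B_k|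
-- (hence k ≤ log_{1+γ} n) and |B_{k+1}| < (1+γ)|B_k|. All out-edges of B_k end in B_{k+1}, so
-- summing over B_k gives |B_k| Δ ≤ q^k (b|E(B_{k+1})| + |B_k| cK) ≤ q^k |B_k| ((1+γ)ρ_b + cK).

module Submission where

open import Defs hiding (sym)
open import Data.Nat as ℕ using (ℕ; zero; suc; NonZero; z≤n; s≤s)
import Data.Nat.Properties as ℕ
open import Data.Nat.ListAction using (sum)
open import Data.Bool using (Bool; true; false; T; if_then_else_; _∧_)
open import Data.Fin using (Fin; toℕ)
open import Data.Fin.Properties using (toℕ-injective; any?)
open import Data.Fin.Subset using (Subset; inside; outside; _∈_; _⊆_; _∪_; ⁅_⁆; ∣_∣)
open import Data.Fin.Subset.Properties
  using (_∈?_; p⊆p∪q; q⊆p∪q; x∈p∪q⁻; x∈⁅y⁆⇒x≡y; ∣⁅x⁆∣≡1; ∣p∣≤n; p⊆q⇒∣p∣≤∣q∣)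
open import Data.List using ([]; _∷_; map; foldr; allFin; tabulate)
open import Data.List.Properties using (map-tabulate)
open import Data.List.Membership.Propositional as List using ()
open import Data.List.Membership.Propositional.Properties using (∈-map⁺; ∈-++⁺ˡ; ∈-++⁺ʳ)
open import Data.List.Relation.Unary.Any using (here; there)
open import Data.Vec as Vec using (lookup; here; there)
open import Data.Vec.Properties using (lookup∘tabulate; []=⇒lookup; lookup⇒[]=)
open import Data.Product using (Σ; ∃-syntax; _×_; _,_)
open import Data.Sum using (_⊎_; inj₁; inj₂)
open import Data.Integer as ℤ using (ℤ; +_)
import Data.Integer.Properties as ℤ
open import Data.Integer.Tactic.RingSolver using (solve-∀)
open import Data.Rational
  using (ℚ; 0ℚ; 1ℚ; _/_; _+_; _*_; _÷_; 1/_; _≤_; _<_; _⊔_; >-nonZero; toℚᵘ; positive; nonNegative)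
open import Data.Rational.Properties
import Data.Rational.Unnormalised as ℚᵘ
import Data.Rational.Unnormalised.Properties as ℚᵘ
open import Data.Rational.Solver using (module +-*-Solver)
open import Algebra.Properties.Semiring.Sum ℕ.+-*-semiring
  using (sum-syntax; sum-cong-≗; ∑-distrib-+; ∑-comm; *-distribˡ-sum)
open import Function using (_∘_; _$_)
open import Relation.Binary as B using (Rel)
open import Relation.Binary.PropositionalEquality
  using (_≡_; _≢_; refl; sym; trans; cong; cong₂; subst; subst₂; module ≡-Reasoning)
open import Relation.Nullary using (yes; no; does; contradiction)
open import Relation.Nullary.Decidable using (dec-true; _×-dec_)
open import Relation.Unary using (Pred; Decidable)

open +-*-Solver

sum-allFin : ∀ {n} (f : Fin n → ℕ) → sum (map f (allFin n)) ≡ ∑[ i < n ] f i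
sum-allFin {zero}  f = refl
sum-allFin {suc n} f = cong (f Fin.zero ℕ.+_) $ begin
  sum (map f (tabulate Fin.suc))      ≡⟨ cong sum (map-tabulate Fin.suc f) ⟩
  sum (tabulate (f ∘ Fin.suc))        ≡⟨ cong sum (map-tabulate (λ i → i) (f ∘ Fin.suc)) ⟨
  sum (map (f ∘ Fin.suc) (allFin n))  ≡⟨ sum-allFin (f ∘ Fin.suc) ⟩
  ∑[ i < n ] f (Fin.suc i)            ∎
  where open ≡-Reasoning

∑-mono-≤ : ∀ {n} (f g : Fin n → ℕ) → (∀ i → f i ℕ.≤ g i) → ∑[ i < n ] f i ℕ.≤ ∑[ i < n ] g i
∑-mono-≤ {zero}  f g f≤g = z≤n
∑-mono-≤ {suc n} f g f≤g = ℕ.+-mono-≤ (f≤g Fin.zero) (∑-mono-≤ (f ∘ Fin.suc) (g ∘ Fin.suc) (f≤g ∘ Fin.suc))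

∑∑-symmetrize : ∀ {n} (f : Fin n → Fin n → ℕ) →
  ∑[ u < n ] ∑[ v < n ] (f u v ℕ.+ f v u) ≡ ∑[ u < n ] ∑[ v < n ] f u v ℕ.+ ∑[ u < n ] ∑[ v < n ] f u v
∑∑-symmetrize {n} f = begin
  ∑[ u < n ] ∑[ v < n ] (f u v ℕ.+ f v u)
    ≡⟨ sum-cong-≗ (λ u → ∑-distrib-+ (f u) (λ v → f v u)) ⟩
  ∑[ u < n ] (∑[ v < n ] f u v ℕ.+ ∑[ v < n ] f v u)
    ≡⟨ ∑-distrib-+ (λ u → ∑[ v < n ] f u v) (λ u → ∑[ v < n ] f v u) ⟩
  ∑[ u < n ] ∑[ v < n ] f u v ℕ.+ ∑[ u < n ] ∑[ v < n ] f v u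
    ≡⟨ cong (∑[ u < n ] ∑[ v < n ] f u v ℕ.+_) (∑-comm (λ v u → f v u)) ⟨
  ∑[ u < n ] ∑[ v < n ] f u v ℕ.+ ∑[ u < n ] ∑[ v < n ] f u v ∎
  where open ≡-Reasoning

halve-≤ : ∀ {x y} → x ℕ.+ x ℕ.≤ y ℕ.+ y → x ℕ.≤ y
halve-≤ {x} {y} x+x≤y+y with x ℕ.≤? y
... | yes x≤y = x≤y
... | no  x≰y = contradiction x+x≤y+y (ℕ.<⇒≱ (ℕ.+-mono-< y<x y<x))
  where
  y<x : y ℕ.< x
  y<x = ℕ.≰⇒> x≰y

fromℕ : ℕ → ℚ
fromℕ m = + m / 1

toℚᵘ-fromℕ : ∀ m → toℚᵘ (fromℕ m) ℚᵘ.≃ ℚᵘ.mkℚᵘ (+ m) 0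
toℚᵘ-fromℕ m = toℚᵘ-fromℚᵘ (ℚᵘ.mkℚᵘ (+ m) 0)

fromℕ-+ : ∀ m k → fromℕ (m ℕ.+ k) ≡ fromℕ m + fromℕ k
fromℕ-+ m k = toℚᵘ-injective $ begin
  toℚᵘ (fromℕ (m ℕ.+ k))                ≈⟨ toℚᵘ-fromℕ (m ℕ.+ k) ⟩
  ℚᵘ.mkℚᵘ (+ (m ℕ.+ k)) 0                ≈⟨ ℚᵘ.*≡* (trans (cong (ℤ._* + 1) (ℤ.pos-+ m k)) (lemma (+ m) (+ k))) ⟩
  ℚᵘ.mkℚᵘ (+ m) 0 ℚᵘ.+ ℚᵘ.mkℚᵘ (+ k) 0  ≈⟨ ℚᵘ.+-cong (toℚᵘ-fromℕ m) (toℚᵘ-fromℕ k) ⟨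
  toℚᵘ (fromℕ m) ℚᵘ.+ toℚᵘ (fromℕ k)    ≈⟨ toℚᵘ-homo-+ (fromℕ m) (fromℕ k) ⟨
  toℚᵘ (fromℕ m + fromℕ k)              ∎
  where
  open ℚᵘ.≃-Reasoning
  lemma : ∀ (x y : ℤ) → (x ℤ.+ y) ℤ.* + 1 ≡ (x ℤ.* + 1 ℤ.+ y ℤ.* + 1) ℤ.* + 1
  lemma = solve-∀

fromℕ-mono-≤ : ∀ {m k} → m ℕ.≤ k → fromℕ m ≤ fromℕ k
fromℕ-mono-≤ {m} {k} m≤k = toℚᵘ-cancel-≤ $
  ℚᵘ.≤-respʳ-≃ (ℚᵘ.≃-sym (toℚᵘ-fromℕ k)) $ ℚᵘ.≤-respˡ-≃ (ℚᵘ.≃-sym (toℚᵘ-fromℕ m)) $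
  ℚᵘ.*≤* (subst₂ ℤ._≤_ (sym (ℤ.*-identityʳ (+ m))) (sym (ℤ.*-identityʳ (+ k))) (ℤ.+≤+ m≤k))

0≤fromℕ : ∀ m → 0ℚ ≤ fromℕ m
0≤fromℕ m = fromℕ-mono-≤ {0} {m} z≤n

fromℕ-cancel-< : ∀ {m k} → fromℕ m < fromℕ k → m ℕ.< k
fromℕ-cancel-< {m} {k} m<k with k ℕ.≤? m
... | yes k≤m = contradiction (<-≤-trans m<k (fromℕ-mono-≤ k≤m)) (<-irrefl refl)
... | no  k≰m = ℕ.≰⇒> k≰m

ratio-*-fromℕ : ∀ m s → ratio m (suc s) * fromℕ (suc s) ≡ fromℕ m
ratio-*-fromℕ m s = toℚᵘ-injective $ begin
  toℚᵘ (ratio m (suc s) * fromℕ (suc s))        ≈⟨ toℚᵘ-homo-* (ratio m (suc s)) (fromℕ (suc s)) ⟩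
  toℚᵘ (ratio m (suc s)) ℚᵘ.* toℚᵘ (fromℕ (suc s))
    ≈⟨ ℚᵘ.*-cong (toℚᵘ-fromℚᵘ (ℚᵘ.mkℚᵘ (+ m) s)) (toℚᵘ-fromℕ (suc s)) ⟩
  ℚᵘ.mkℚᵘ (+ m) s ℚᵘ.* ℚᵘ.mkℚᵘ (+ suc s) 0
    ≈⟨ ℚᵘ.*≡* (trans (lemma (+ m) (+ suc s)) (cong (+ m ℤ.*_) (sym (ℤ.pos-* (suc s) 1)))) ⟩
  ℚᵘ.mkℚᵘ (+ m) 0                               ≈⟨ toℚᵘ-fromℕ m ⟨
  toℚᵘ (fromℕ m)                                ∎
  where
  open ℚᵘ.≃-Reasoning
  lemma : ∀ (x y : ℤ) → (x ℤ.* y) ℤ.* + 1 ≡ x ℤ.* (y ℤ.* + 1)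
  lemma = solve-∀

1/b*b≡1 : ∀ b .{{_ : NonZero b}} → ((+ 1) / b) * fromℕ b ≡ 1ℚ
1/b*b≡1 (suc b) = ratio-*-fromℕ 1 b

*-mono-≤-nonNegˡ : ∀ {r p q} → 0ℚ ≤ r → p ≤ q → r * p ≤ r * q
*-mono-≤-nonNegˡ {r} 0≤r = *-monoˡ-≤-nonNeg r {{nonNegative 0≤r}}

*-mono-≤-nonNegʳ : ∀ {r p q} → 0ℚ ≤ r → p ≤ q → p * r ≤ q * r
*-mono-≤-nonNegʳ {r} 0≤r = *-monoʳ-≤-nonNeg r {{nonNegative 0≤r}}

*-nonNeg : ∀ {p q} → 0ℚ ≤ p → 0ℚ ≤ q → 0ℚ ≤ p * q
*-nonNeg {p} {q} 0≤p 0≤q =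
  nonNegative⁻¹ (p * q) {{nonNeg*nonNeg⇒nonNeg p {{nonNegative 0≤p}} q {{nonNegative 0≤q}}}}

p≤p+q : ∀ {p q} → 0ℚ ≤ q → p ≤ p + q
p≤p+q {p} 0≤q = subst (_≤ p + _) (+-identityʳ p) (+-monoʳ-≤ p 0≤q)

p≤r*p : ∀ {r p} → 1ℚ ≤ r → 0ℚ ≤ p → p ≤ r * p
p≤r*p {r} {p} 1≤r 0≤p = subst (_≤ r * p) (*-identityˡ p) (*-mono-≤-nonNegʳ 0≤p 1≤r)

^ℚ-nonNeg : ∀ {q} → 0ℚ ≤ q → ∀ k → 0ℚ ≤ q ^ℚ k
^ℚ-nonNeg 0≤q zero    = 0≤fromℕ 1
^ℚ-nonNeg 0≤q (suc k) = *-nonNeg 0≤q (^ℚ-nonNeg 0≤q k)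

ratio-bound : ∀ {m s ρ} → 0 ℕ.< s → ratio m s ≤ ρ → fromℕ m ≤ ρ * fromℕ s
ratio-bound {m} {suc s} {ρ} _ ratio≤ρ = begin
  fromℕ m                        ≡⟨ ratio-*-fromℕ m s ⟨
  ratio m (suc s) * fromℕ (suc s) ≤⟨ *-mono-≤-nonNegʳ (0≤fromℕ (suc s)) ratio≤ρ ⟩
  ρ * fromℕ (suc s)              ∎
  where open ≤-Reasoning

potential-step : ∀ {c} q K x → 0ℚ ≤ c → K + 1ℚ ≤ q * K → q * x + c + c * K ≤ q * (x + c * K)
potential-step {c} q K x c≥0 K+1≤qK = begin
  q * x + c + c * K       ≡⟨ solve 4 (λ q c K x → q :* x :+ c :+ c :* K := q :* x :+ c :* (K :+ con 1ℚ)) refl q c K x ⟩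
  q * x + c * (K + 1ℚ)    ≤⟨ +-monoʳ-≤ (q * x) (*-mono-≤-nonNegˡ c≥0 K+1≤qK) ⟩
  q * x + c * (q * K)     ≡⟨ solve 4 (λ q c K x → q :* x :+ c :* (q :* K) := q :* (x :+ c :* K)) refl q c K x ⟩
  q * (x + c * K)         ∎
  where open ≤-Reasoning

K+1≤qK : ∀ η r B i → r * B ≡ 1ℚ → η * i ≡ 1ℚ → 0ℚ ≤ η * r →
  (B * i + 1ℚ) + 1ℚ ≤ (1ℚ + η * r) * (B * i + 1ℚ)
K+1≤qK η r B i rB≡1 ηi≡1 ηr≥0 = begin
  K + 1ℚ                         ≤⟨ p≤p+q ηr≥0 ⟩
  K + 1ℚ + η * r                 ≡⟨ cong (λ x → K + x + η * r) (*-identityˡ 1ℚ) ⟨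
  K + 1ℚ * 1ℚ + η * r            ≡⟨ cong (λ x → K + x + η * r) (cong₂ _*_ ηi≡1 rB≡1) ⟨
  K + (η * i) * (r * B) + η * r  ≡⟨ solve 4 (λ η r B i → (B :* i :+ con 1ℚ) :+ (η :* i) :* (r :* B) :+ η :* r
                                                       := (con 1ℚ :+ η :* r) :* (B :* i :+ con 1ℚ)) refl η r B i ⟩
  (1ℚ + η * r) * K               ∎
  where
  open ≤-Reasoning
  K = B * i + 1ℚ

-- A bounded sequence cannot grow geometrically for long

GrowthStallsAt : ℚ → (ℕ → ℕ) → ℕ → Set
GrowthStallsAt γ s k = ((1ℚ + γ) ^ℚ k ≤ fromℕ (s k)) × (fromℕ (s (suc k)) < (1ℚ + γ) * fromℕ (s k))

growth-stalls : ∀ {γ} → 0ℚ < γ → (s : ℕ → ℕ) {N : ℕ} → (∀ i → s i ℕ.≤ N) → 1 ℕ.≤ s 0 →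
  ∃[ k ] GrowthStallsAt γ s k
growth-stalls {γ} γ>0 s {N} s≤N 1≤s₀ = search N 0 ℕ.≤-refl 1≤s₀ (fromℕ-mono-≤ {1} {s 0} 1≤s₀)
  where
  x<[1+γ]x : ∀ {x} → 0ℚ < x → x < (1ℚ + γ) * x
  x<[1+γ]x {x} x>0 = begin-strict
    x               ≡⟨ +-identityʳ x ⟨
    x + 0ℚ          <⟨ +-monoʳ-< x (positive⁻¹ (γ * x) {{pos*pos⇒pos γ {{positive γ>0}} x {{positive x>0}}}}) ⟩
    x + γ * x       ≡⟨ solve 2 (λ x γ → x :+ γ :* x := (con 1ℚ :+ γ) :* x) refl x γ ⟩
    (1ℚ + γ) * x    ∎
    where open ≤-Reasoning

  -- Every step that does not stall increases s strictly, keeping i < s i ≤ N; so fuel N suffices.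
  search : ∀ fuel i → N ℕ.≤ i ℕ.+ fuel → i ℕ.< s i → (1ℚ + γ) ^ℚ i ≤ fromℕ (s i) → ∃[ k ] GrowthStallsAt γ s k
  search zero i N≤i i<sᵢ _ = contradiction (ℕ.≤-trans i<sᵢ (ℕ.≤-trans (s≤N i) N≤i)) (ℕ.<-irrefl (sym (ℕ.+-identityʳ i)))
  search (suc fuel) i N≤i+1+fuel i<sᵢ powᵢ≤sᵢ with (1ℚ + γ) * fromℕ (s i) ≤? fromℕ (s (suc i))
  ... | no  stalled = i , powᵢ≤sᵢ , ≰⇒> stalled
  ... | yes grown   = search fuel (suc i) (subst (N ℕ.≤_) (ℕ.+-suc i fuel) N≤i+1+fuel)
                        (ℕ.≤-trans (s≤s i<sᵢ) sᵢ<sᵢ₊₁) (≤-trans (*-mono-≤-nonNegˡ 0≤1+γ powᵢ≤sᵢ) grown)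
    where
    0≤1+γ : 0ℚ ≤ 1ℚ + γ
    0≤1+γ = ≤-trans (0≤fromℕ 1) (p≤p+q (<⇒≤ γ>0))
    sᵢ>0 : 0ℚ < fromℕ (s i)
    sᵢ>0 = <-≤-trans (positive⁻¹ 1ℚ) (fromℕ-mono-≤ {1} {s i} (ℕ.≤-trans (s≤s z≤n) i<sᵢ))
    sᵢ<sᵢ₊₁ : s i ℕ.< s (suc i)
    sᵢ<sᵢ₊₁ = fromℕ-cancel-< (<-≤-trans (x<[1+γ]x sᵢ>0) grown)

foldr-⊔-attained : ∀ {A : Set} (f : A → ℕ) x xs → ∃[ y ] foldr ℕ._⊔_ 0 (map f (x ∷ xs)) ≡ f y
foldr-⊔-attained f x []       = x , ℕ.⊔-identityʳ (f x)
foldr-⊔-attained f x (x′ ∷ xs) with foldr-⊔-attained f x′ xs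
... | y , max≡fy with ℕ.⊔-sel (f x) (foldr ℕ._⊔_ 0 (map f (x′ ∷ xs)))
...   | inj₁ ⊔≡fx = x , ⊔≡fx
...   | inj₂ ⊔≡max = y , trans ⊔≡max max≡fy

foldr-⊔-upper : ∀ {A : Set} (f : A → ℚ) {x xs} → x List.∈ xs → f x ≤ foldr _⊔_ 0ℚ (map f xs)
foldr-⊔-upper f {xs = y ∷ ys} (here refl) = p≤p⊔q (f y) _
foldr-⊔-upper f {xs = y ∷ ys} (there x∈ys) = ≤-trans (foldr-⊔-upper f x∈ys) (p≤q⊔p (f y) _)

0≤foldr-⊔ : ∀ {A : Set} (f : A → ℚ) xs → 0ℚ ≤ foldr _⊔_ 0ℚ (map f xs)
0≤foldr-⊔ f []       = ≤-refl
0≤foldr-⊔ f (y ∷ ys) = ≤-trans (0≤foldr-⊔ f ys) (p≤q⊔p (f y) _)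

∈-allSubsets : ∀ {n} (p : Subset n) → p List.∈ allSubsets n
∈-allSubsets Vec.[] = here refl
∈-allSubsets {suc n} (inside  Vec.∷ p) = ∈-++⁺ˡ (∈-map⁺ (inside Vec.∷_) (∈-allSubsets p))
∈-allSubsets {suc n} (outside Vec.∷ p) =
  ∈-++⁺ʳ (map (inside Vec.∷_) (allSubsets n)) (∈-map⁺ (outside Vec.∷_) (∈-allSubsets p))

maxOutdeg-attained : ∀ {m} {G : Graph (suc m)} {b} (o : Orientation G b) → ∃[ v ] maxOutdeg o ≡ outdeg o v
maxOutdeg-attained o = foldr-⊔-attained (outdeg o) Fin.zero (tabulate Fin.suc)

0≤maxDensityᵇ : ∀ {n} (G : Graph n) b → 0ℚ ≤ maxDensityᵇ G b
0≤maxDensityᵇ {n} G b = 0≤foldr-⊔ (densityᵇ G b) (allSubsets n)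

edges≤maxDensityᵇ*∣S∣ : ∀ {n} (G : Graph n) b {S} → 0 ℕ.< ∣ S ∣ →
  fromℕ (b ℕ.* edgesIn G S) ≤ maxDensityᵇ G b * fromℕ ∣ S ∣
edges≤maxDensityᵇ*∣S∣ G b {S} ∣S∣>0 =
  ratio-bound ∣S∣>0 (foldr-⊔-upper (densityᵇ G b) (∈-allSubsets S))

-- Out-balls of a decidable relation on Fin n

module _ {ℓ} {n} {P : Pred (Fin n) ℓ} (P? : Decidable P) where

  subsetOf : Subset n
  subsetOf = Vec.tabulate (does ∘ P?)

  ∈-subsetOf⁺ : ∀ {v} → P v → v ∈ subsetOf
  ∈-subsetOf⁺ {v} pv = lookup⇒[]= v subsetOf (trans (lookup∘tabulate (does ∘ P?) v) (dec-true (P? v) pv))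

  ∈-subsetOf⁻ : ∀ {v} → v ∈ subsetOf → P v
  ∈-subsetOf⁻ {v} v∈ with P? v | trans (sym (lookup∘tabulate (does ∘ P?) v)) ([]=⇒lookup v∈)
  ... | yes pv | _ = pv
  ... | no  _  | ()

module OutBall {ℓ} {n} {_⇒_ : Rel (Fin n) ℓ} (_⇒?_ : B.Decidable _⇒_) where

  successor? : (S : Subset n) → Decidable (λ v → ∃[ u ] u ∈ S × u ⇒ v)
  successor? S v = any? (λ u → u ∈? S ×-dec u ⇒? v)

  successors : Subset n → Subset n
  successors S = subsetOf (successor? S)

  ball : Fin n → ℕ → Subset n
  ball v₀ zero    = ⁅ v₀ ⁆
  ball v₀ (suc i) = ball v₀ i ∪ successors (ball v₀ i)

  ball-⊆-suc : ∀ v₀ i → ball v₀ i ⊆ ball v₀ (suc i)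
  ball-⊆-suc v₀ i = p⊆p∪q (successors (ball v₀ i))

  ⁅v₀⁆⊆ball : ∀ v₀ i → ⁅ v₀ ⁆ ⊆ ball v₀ i
  ⁅v₀⁆⊆ball v₀ zero    = λ v∈ → v∈
  ⁅v₀⁆⊆ball v₀ (suc i) = ball-⊆-suc v₀ i ∘ ⁅v₀⁆⊆ball v₀ i

  ∣ball∣>0 : ∀ v₀ i → 0 ℕ.< ∣ ball v₀ i ∣
  ∣ball∣>0 v₀ i = subst (ℕ._≤ ∣ ball v₀ i ∣) (∣⁅x⁆∣≡1 v₀) (p⊆q⇒∣p∣≤∣q∣ (⁅v₀⁆⊆ball v₀ i))

  ball-step : ∀ {v₀ i u v} → u ∈ ball v₀ i → u ⇒ v → v ∈ ball v₀ (suc i)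
  ball-step {v₀} {i} u∈ u⇒v = q⊆p∪q (ball v₀ i) _ (∈-subsetOf⁺ (successor? (ball v₀ i)) (_ , u∈ , u⇒v))

  ball-suc⁻ : ∀ {v₀ i v} → v ∈ ball v₀ (suc i) → v ∈ ball v₀ i ⊎ ∃[ u ] u ∈ ball v₀ i × u ⇒ v
  ball-suc⁻ {v₀} {i} v∈ with x∈p∪q⁻ (ball v₀ i) _ v∈
  ... | inj₁ v∈ball = inj₁ v∈ball
  ... | inj₂ v∈succ = inj₂ (∈-subsetOf⁻ (successor? (ball v₀ i)) v∈succ)

  module _ (φ : Fin n → ℚ) {q c K : ℚ} (φ≥0 : ∀ v → 0ℚ ≤ φ v) (1≤q : 1ℚ ≤ q) (c≥0 : 0ℚ ≤ c) (K≥0 : 0ℚ ≤ K)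
           (K+1≤qK : K + 1ℚ ≤ q * K) (φ-step : ∀ {u v} → u ⇒ v → φ u ≤ q * φ v + c) where

    q^-nonNeg : ∀ i → 0ℚ ≤ q ^ℚ i
    q^-nonNeg = ^ℚ-nonNeg (≤-trans (0≤fromℕ 1) 1≤q)

    ball-potential : ∀ {D v₀} → D ≤ φ v₀ → ∀ i {v} → v ∈ ball v₀ i → D ≤ q ^ℚ i * (φ v + c * K)
    ball-potential {D} {v₀} D≤φv₀ zero v∈ rewrite x∈⁅y⁆⇒x≡y v₀ v∈ = begin
      D                      ≤⟨ D≤φv₀ ⟩
      φ v₀                   ≤⟨ p≤p+q (*-nonNeg c≥0 K≥0) ⟩
      φ v₀ + c * K           ≡⟨ *-identityˡ _ ⟨
      1ℚ * (φ v₀ + c * K)    ∎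
      where open ≤-Reasoning
    ball-potential {D} {v₀} D≤φv₀ (suc i) {v} v∈ with ball-suc⁻ {v₀} {i} v∈
    ... | inj₁ v∈ball = begin
      D                      ≤⟨ ball-potential D≤φv₀ i v∈ball ⟩
      Q * X                  ≤⟨ p≤r*p 1≤q (*-nonNeg (q^-nonNeg i) (≤-trans (φ≥0 v) (p≤p+q (*-nonNeg c≥0 K≥0)))) ⟩
      q * (Q * X)            ≡⟨ *-assoc q Q X ⟨
      q * Q * X              ∎
      where
      open ≤-Reasoning
      Q X : ℚ
      Q = q ^ℚ i
      X = φ v + c * K
    ... | inj₂ (u , u∈ball , u⇒v) = begin
      D                      ≤⟨ ball-potential D≤φv₀ i u∈ball ⟩
      Q * (φ u + c * K)      ≤⟨ *-mono-≤-nonNegˡ (q^-nonNeg i) (+-monoˡ-≤ (c * K) (φ-step u⇒v)) ⟩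
      Q * (q * φ v + c + c * K) ≤⟨ *-mono-≤-nonNegˡ (q^-nonNeg i) (potential-step q K (φ v) c≥0 K+1≤qK) ⟩
      Q * (q * X)            ≡⟨ solve 3 (λ q Q X → Q :* (q :* X) := q :* Q :* X) refl q Q X ⟩
      q * Q * X              ∎
      where
      open ≤-Reasoning
      Q X : ℚ
      Q = q ^ℚ i
      X = φ v + c * K

-- Double counting the edges inside a vertex set

sumOver : ∀ {n} → Subset n → (Fin n → ℕ) → ℕ
sumOver {n} S f = ∑[ u < n ] (if lookup S u then f u else 0)

sumOver-bound : ∀ {n} (S : Subset n) (f : Fin n → ℕ) {D Q Y : ℚ} →
  (∀ {u} → u ∈ S → D ≤ Q * (fromℕ (f u) + Y)) →
  fromℕ ∣ S ∣ * D ≤ Q * (fromℕ (sumOver S f) + fromℕ ∣ S ∣ * Y)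
sumOver-bound Vec.[] f {D} {Q} {Y} _ =
  ≤-reflexive (solve 3 (λ D Q Y → con 0ℚ :* D := Q :* (con 0ℚ :+ con 0ℚ :* Y)) refl D Q Y)
sumOver-bound (outside Vec.∷ S) f {D} {Q} {Y} bound =
  sumOver-bound S (f ∘ Fin.suc) {D} {Q} {Y} (bound ∘ there)
sumOver-bound (inside Vec.∷ S) f {D} {Q} {Y} bound = begin
  fromℕ (suc ∣ S ∣) * D                               ≡⟨ cong (_* D) (fromℕ-+ 1 ∣ S ∣) ⟩
  (1ℚ + s) * D                                        ≡⟨ solve 2 (λ s D → (con 1ℚ :+ s) :* D := D :+ s :* D) refl s D ⟩
  D + s * D                                           ≤⟨ +-mono-≤ (bound here)
                                                          (sumOver-bound S (f ∘ Fin.suc) {D} {Q} {Y} (bound ∘ there)) ⟩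
  Q * (f₀ + Y) + Q * (t + s * Y)                      ≡⟨ solve 5 (λ Q f₀ Y t s → Q :* (f₀ :+ Y) :+ Q :* (t :+ s :* Y)
                                                                := Q :* ((f₀ :+ t) :+ (con 1ℚ :+ s) :* Y)) refl Q f₀ Y t s ⟩
  Q * ((f₀ + t) + (1ℚ + s) * Y)                       ≡⟨ cong₂ (λ x y → Q * (x + y * Y)) (fromℕ-+ (f Fin.zero) _) (fromℕ-+ 1 ∣ S ∣) ⟨
  Q * (fromℕ (sumOver (inside Vec.∷ S) f) + fromℕ (suc ∣ S ∣) * Y) ∎
  where
  open ≤-Reasoning
  s f₀ t : ℚ
  s = fromℕ ∣ S ∣
  f₀ = fromℕ (f Fin.zero)
  t = fromℕ (sumOver S (f ∘ Fin.suc))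

*-indicator : ∀ b c → b ℕ.* (if c then 1 else 0) ≡ (if c then b else 0)
*-indicator b true  = ℕ.*-identityʳ b
*-indicator b false = ℕ.*-zeroʳ b

<ᵇ-connex : ∀ {n} {u v : Fin n} → u ≢ v → T (toℕ u ℕ.<ᵇ toℕ v) ⊎ T (toℕ v ℕ.<ᵇ toℕ u)
<ᵇ-connex {n} {u} {v} u≢v with ℕ.<-cmp (toℕ u) (toℕ v)
... | B.tri< u<v _ _ = inj₁ (ℕ.<⇒<ᵇ u<v)
... | B.tri≈ _ u≡v _ = contradiction (toℕ-injective u≡v) u≢v
... | B.tri> _ _ v<u = inj₂ (ℕ.<⇒<ᵇ v<u)

b≤one-of : ∀ {x y} b → T x ⊎ T y → b ℕ.≤ (if x ∧ true then b else 0) ℕ.+ (if y ∧ true then b else 0)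
b≤one-of {true}          b _         = ℕ.m≤m+n b _
b≤one-of {false} {true}  b _         = ℕ.≤-refl
b≤one-of {false} {false} b (inj₁ ())
b≤one-of {false} {false} b (inj₂ ())

module _ {n} {G : Graph n} {b} (o : Orientation G b) where

  inducedOut : Subset n → Fin n → Fin n → ℕ
  inducedOut S u v = if lookup S u ∧ lookup S v then out o u v else 0

  countedEdge : Subset n → Fin n → Fin n → Bool
  countedEdge S u v = (toℕ u ℕ.<ᵇ toℕ v) ∧ adj G u v ∧ lookup S u ∧ lookup S v

  edgeWeight : Subset n → Fin n → Fin n → ℕ
  edgeWeight S u v = if countedEdge S u v then b else 0

  b*edgesIn≡∑∑edgeWeight : ∀ S → b ℕ.* edgesIn G S ≡ ∑[ u < n ] ∑[ v < n ] edgeWeight S u v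
  b*edgesIn≡∑∑edgeWeight S = begin
    b ℕ.* edgesIn G S
      ≡⟨ cong (b ℕ.*_) (trans (sum-allFin (λ u → sum (map (indicator u) (allFin n))))
                              (sum-cong-≗ (λ u → sum-allFin (indicator u)))) ⟩
    b ℕ.* ∑[ u < n ] ∑[ v < n ] indicator u v
      ≡⟨ *-distribˡ-sum b (λ u → ∑[ v < n ] indicator u v) ⟩
    ∑[ u < n ] (b ℕ.* ∑[ v < n ] indicator u v)
      ≡⟨ sum-cong-≗ (λ u → trans (*-distribˡ-sum b (indicator u)) (sum-cong-≗ (λ v → *-indicator b (countedEdge S u v)))) ⟩
    ∑[ u < n ] ∑[ v < n ] edgeWeight S u v
      ∎
    where
    open ≡-Reasoning
    indicator : Fin n → Fin n → ℕ
    indicator u v = if countedEdge S u v then 1 else 0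

  -- The b copies of an edge {u,v} of S give out u v + out v u = b on the left, and edgeWeight
  -- charges b to exactly one of (u,v) and (v,u).
  inducedOut-pair≤ : ∀ S u v → inducedOut S u v ℕ.+ inducedOut S v u ℕ.≤ edgeWeight S u v ℕ.+ edgeWeight S v u
  inducedOut-pair≤ S u v with lookup S u | lookup S v
  ... | false | false = z≤n
  ... | false | true  = z≤n
  ... | true  | false = z≤n
  ... | true  | true  rewrite Graph.sym G v u with adj G u v in uv
  ...   | false rewrite out-nonadj o u v uv | out-nonadj o v u (trans (Graph.sym G v u) uv) = z≤n
  ...   | true  rewrite out-split o u v uv = b≤one-of b (<ᵇ-connex u≢v)
    where
    u≢v : u ≢ v
    u≢v refl = contradiction (trans (sym uv) (irrefl G u)) λ ()

  ∑∑inducedOut≤b*edgesIn : ∀ S → ∑[ u < n ] ∑[ v < n ] inducedOut S u v ℕ.≤ b ℕ.* edgesIn G S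
  ∑∑inducedOut≤b*edgesIn S = ℕ.≤-trans ∑∑inducedOut≤∑∑edgeWeight (ℕ.≤-reflexive (sym (b*edgesIn≡∑∑edgeWeight S)))
    where
    ∑∑inducedOut≤∑∑edgeWeight : ∑[ u < n ] ∑[ v < n ] inducedOut S u v ℕ.≤ ∑[ u < n ] ∑[ v < n ] edgeWeight S u v
    ∑∑inducedOut≤∑∑edgeWeight = halve-≤ $
      subst₂ ℕ._≤_ (∑∑-symmetrize (inducedOut S)) (∑∑-symmetrize (edgeWeight S)) $
        ∑-mono-≤ _ _ λ u → ∑-mono-≤ (λ v → inducedOut S u v ℕ.+ inducedOut S v u)
                                    (λ v → edgeWeight S u v ℕ.+ edgeWeight S v u) (inducedOut-pair≤ S u)

  out≤inducedOut : ∀ {S u v} → u ∈ S → (IsDirectedEdge o u v → v ∈ S) → out o u v ℕ.≤ inducedOut S u v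
  out≤inducedOut {S} {u} {v} u∈S closed rewrite []=⇒lookup u∈S with out o u v
  ... | zero  = z≤n
  ... | suc _ rewrite []=⇒lookup (closed (s≤s z≤n)) = ℕ.≤-refl

  sumOver-outdeg≤b*edgesIn : ∀ {S S′} → S ⊆ S′ → (∀ {u v} → u ∈ S → IsDirectedEdge o u v → v ∈ S′) →
    sumOver S (outdeg o) ℕ.≤ b ℕ.* edgesIn G S′
  sumOver-outdeg≤b*edgesIn {S} {S′} S⊆S′ closed = ℕ.≤-trans (∑-mono-≤ _ _ bound) (∑∑inducedOut≤b*edgesIn S′)
    where
    bound : ∀ u → (if lookup S u then outdeg o u else 0) ℕ.≤ ∑[ v < n ] inducedOut S′ u v
    bound u with lookup S u in u∈S
    ... | false = z≤n
    ... | true  = subst (ℕ._≤ ∑[ v < n ] inducedOut S′ u v) (sym (sum-allFin (out o u)))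
                    (∑-mono-≤ (out o u) (inducedOut S′ u) λ v → out≤inducedOut (S⊆S′ u∈) (closed u∈))
      where
      u∈ : u ∈ S
      u∈ = lookup⇒[]= u S u∈S

stalled-set-bound : ∀ {n} {G : Graph n} {b} (o : Orientation G b) {S S′ : Subset n} {D Q C γ : ℚ} →
  0ℚ ≤ Q → 0ℚ ≤ γ → 0 ℕ.< ∣ S ∣ → S ⊆ S′ → (∀ {u v} → u ∈ S → IsDirectedEdge o u v → v ∈ S′) →
  fromℕ ∣ S′ ∣ ≤ (1ℚ + γ) * fromℕ ∣ S ∣ →
  (∀ {u} → u ∈ S → D ≤ Q * (fromℕ (outdeg o u) + C)) →
  D ≤ Q * ((1ℚ + γ) * maxDensityᵇ G b + C)
stalled-set-bound {G = G} {b} o {S} {S′} {D} {Q} {C} {γ} Q≥0 γ≥0 ∣S∣>0 S⊆S′ closed stalled potential =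
  *-cancelˡ-≤-pos a {{positive a>0}} $ begin
    a * D                                   ≤⟨ sumOver-bound S (outdeg o) {D} {Q} {C} potential ⟩
    Q * (fromℕ (sumOver S (outdeg o)) + a * C) ≤⟨ *-mono-≤-nonNegˡ Q≥0 (+-monoˡ-≤ (a * C) outdeg-sum≤) ⟩
    Q * (ρ * ((1ℚ + γ) * a) + a * C)        ≡⟨ solve 5 (λ a Q C γ ρ → Q :* (ρ :* ((con 1ℚ :+ γ) :* a) :+ a :* C)
                                                        := a :* (Q :* ((con 1ℚ :+ γ) :* ρ :+ C))) refl a Q C γ ρ ⟩
    a * (Q * ((1ℚ + γ) * ρ + C))            ∎
  where
  open ≤-Reasoning
  a ρ : ℚ
  a = fromℕ ∣ S ∣
  ρ = maxDensityᵇ G b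
  a>0 : 0ℚ < a
  a>0 = <-≤-trans (positive⁻¹ 1ℚ) (fromℕ-mono-≤ ∣S∣>0)
  outdeg-sum≤ : fromℕ (sumOver S (outdeg o)) ≤ ρ * ((1ℚ + γ) * a)
  outdeg-sum≤ = begin
    fromℕ (sumOver S (outdeg o))  ≤⟨ fromℕ-mono-≤ (sumOver-outdeg≤b*edgesIn o S⊆S′ closed) ⟩
    fromℕ (b ℕ.* edgesIn G S′)    ≤⟨ edges≤maxDensityᵇ*∣S∣ G b {S′} (ℕ.≤-trans ∣S∣>0 (p⊆q⇒∣p∣≤∣q∣ S⊆S′)) ⟩
    ρ * fromℕ ∣ S′ ∣              ≤⟨ *-mono-≤-nonNegˡ (0≤maxDensityᵇ G b) stalled ⟩
    ρ * ((1ℚ + γ) * a)            ∎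

theorem1 : (n : ℕ) → 1 ℕ.≤ n → (G : Graph n) → (b : ℕ) → .{{_ : NonZero b}} →
    (η : ℚ) → (ηpos : 0ℚ < η) → (c : ℚ) → 0ℚ ≤ c →
    (o : Orientation G b) →
    (∀ u v → IsDirectedEdge o u v →
      (+ outdeg o u) / 1 ≤ (1ℚ + η * ((+ 1) / b)) * ((+ outdeg o v) / 1) + c) →
    (γ : ℚ) → 0ℚ < γ →
    Σ ℕ (λ kmax →
      ((1ℚ + γ) ^ℚ kmax ≤ (+ n) / 1)
      × ((+ maxOutdeg o) / 1
          ≤ ((1ℚ + η * ((+ 1) / b)) ^ℚ kmax)
            * ((1ℚ + γ) * maxDensityᵇ G b
               + c * ((_÷_ ((+ b) / 1) η {{>-nonZero ηpos}}) + 1ℚ))))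
theorem1 (suc m) _ G b η η>0 c c≥0 o H γ γ>0 =
  let (v₀ , Δ≡outdeg-v₀) = maxOutdeg-attained o
      (k , growth , stalled) = growth-stalls γ>0 (λ i → ∣ ball v₀ i ∣) (λ i → ∣p∣≤n (ball v₀ i))
                                 (ℕ.≤-reflexive (sym (∣⁅x⁆∣≡1 v₀)))
  in k
   , ≤-trans growth (fromℕ-mono-≤ (∣p∣≤n (ball v₀ k)))
   , stalled-set-bound o (^ℚ-nonNeg (≤-trans (0≤fromℕ 1) 1≤q) k) (<⇒≤ γ>0) (∣ball∣>0 v₀ k) (ball-⊆-suc v₀ k)
       (ball-step {v₀} {k}) (<⇒≤ stalled)
       (ball-potential (fromℕ ∘ outdeg o) (0≤fromℕ ∘ outdeg o) 1≤q c≥0 K≥0 K+1≤qK′ (λ {u} {v} → H u v)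
          (≤-reflexive (cong fromℕ Δ≡outdeg-v₀)) k)
  where
  open OutBall (λ u v → 0 ℕ.<? out o u v)
  η/b≥0 : 0ℚ ≤ η * ((+ 1) / b)
  η/b≥0 = *-nonNeg (<⇒≤ η>0) (nonNegative⁻¹ _ {{normalize-nonNeg 1 b}})
  1≤q : 1ℚ ≤ 1ℚ + η * ((+ 1) / b)
  1≤q = p≤p+q η/b≥0
  1/η : ℚ
  1/η = (1/ η) {{>-nonZero η>0}}
  K≥0 : 0ℚ ≤ (fromℕ b * 1/η) + 1ℚ
  K≥0 = ≤-trans (*-nonNeg (0≤fromℕ b) (<⇒≤ (positive⁻¹ 1/η {{1/pos⇒pos η {{positive η>0}}}}))) (p≤p+q (0≤fromℕ 1))
  K+1≤qK′ : (fromℕ b * 1/η + 1ℚ) + 1ℚ ≤ (1ℚ + η * ((+ 1) / b)) * (fromℕ b * 1/η + 1ℚ)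
  K+1≤qK′ = K+1≤qK η ((+ 1) / b) (fromℕ b) 1/η (1/b*b≡1 b) (*-inverseʳ η {{>-nonZero η>0}}) η/b≥0
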